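{- Let $p$ be a prime, $G\cong\mathbb{Z}_p^n$, and let $\mathcal{CM}$ be a regular Cayley map of $G$ with $X=\mathrm{Aut}(\mathcal{CM})$ and point-stabiliser $\langle\sigma\rangle$ of order $kp^m$, $p\nmid k$. Suppose $X=T\rtimes\langle\sigma\rangle$, where $T\cong\mathbb{Z}_p^n$ is a normal subgroup of $X$ acting regularly on vertices, and identify $X$ with a subgroup of $\mathrm{AGL}(n,p)$ so that $T$ is the translation group $V(n,p)$ and $\sigma\in\mathrm{GL}(n,p)$ with $\sigma^{ -1}t\sigma=\sigma(t)$ for $t\in T$. Let $\ell$ be an involution with $X=\langle\sigma,\ell\rangle$. Then $\ell=t(-I)$ for some $t\in T$ such that $T$ is the normal closure $\langle t\rangle^X$ of $\langle t\rangle$ in $X$; and if $p$ is odd then $\sigma^{kp^m/2}=-I$.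
   Context: A Cayley map of $G$ is the embedding of a Cayley graph $\mathrm{Cay}(G,S)$ into an orientable surface with local rotation at each vertex $g$ given by $(g,gs)\mapsto(g,g\rho(s))$ for a fixed cyclic permutation $\rho$ of $S$; it is regular if its orientation-preserving automorphism group $\mathrm{Aut}(\mathcal{CM})$ acts regularly on arcs, in which case the vertex stabiliser (point-stabiliser) is cyclic, it is core-free in $\mathrm{Aut}(\mathcal{CM})$, and its order is even when $p$ is odd. $-I$ denotes the negation map of $V(n,p)$ ($-I=I$ if $p=2$), and $t(-I)$ is the product of $t$ and $-I$ in $\mathrm{AGL}(n,p)$. -}

module Defs where

open import Data.Nat using (ℕ; zero; suc; _+_; _*_; _∸_; NonZero)
open import Data.Nat.DivMod using (_mod_)
open import Data.Fin using (Fin; toℕ)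
open import Data.Vec using (Vec; map; zipWith; foldr′; lookup; replicate)
open import Data.Product using (Σ; ∃; _×_; _,_)
open import Relation.Binary.PropositionalEquality using (_≡_; _≢_)
open import Relation.Nullary using (¬_)

-- Permutations of V(n,p) are
-- functions V → V, compared pointwise (_≈_).
module Aff (p : ℕ) .{{nz : NonZero p}} (n : ℕ) where

  F : Set
  F = Fin p

  0F : F
  0F = 0 mod p

  _+F_ : F → F → F
  a +F b = (toℕ a + toℕ b) mod p

  _*F_ : F → F → F
  a *F b = (toℕ a * toℕ b) mod p

  -F_ : F → F
  -F a = (p ∸ toℕ a) mod p

  V : Set
  V = Vec F n

  0V : V
  0V = replicate n 0F

  _+V_ : V → V → V
  _+V_ = zipWith _+F_

  -V_ : V → V
  -V_ = map -F_

  Mat : Set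
  Mat = Vec (Vec F n) n

  lin : Mat → V → V
  lin A x = map (λ row → foldr′ _+F_ 0F (zipWith _*F_ row x)) A

  Map : Set
  Map = V → V

  _≈_ : Map → Map → Set
  f ≈ g = ∀ x → f x ≡ g x

  idM : Map
  idM x = x

  _∘M_ : Map → Map → Map
  (f ∘M g) x = f (g x)

  pow : Map → ℕ → Map
  pow f zero = idM
  pow f (suc i) = f ∘M pow f i

  trans : V → Map
  trans t x = t +V x

  negI : Map
  negI = -V_

  IsInvertible : Mat → Set
  IsInvertible A = Σ Mat λ B → ((lin B ∘M lin A) ≈ idM) × ((lin A ∘M lin B) ≈ idM)

  IsBijection : Map → Set
  IsBijection f = Σ Map λ g → ((g ∘M f) ≈ idM) × ((f ∘M g) ≈ idM)

  HasOrder : Map → ℕ → Set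
  HasOrder f N = (pow f N ≈ idM) × (∀ i → 0 Data.Nat.< i → i Data.Nat.< N → ¬ (pow f i ≈ idM))

  IsInvolution : Map → Set
  IsInvolution f = ((f ∘M f) ≈ idM) × ¬ (f ≈ idM)

  -- Cayley map CM(G,S,ρ) of G = ℤ_p^n.  The connection set S is listed as a
  -- vector s₀,…,s_d in the cyclic order ρ, i.e. ρ(sᵢ) = s_{i+1 mod (d+1)}.
  record CayleyMap : Set where
    field
      d        : ℕ
      S        : Vec V (suc d)
      distinct : ∀ i j → lookup S i ≡ lookup S j → i ≡ j
      nonzero  : ∀ i → lookup S i ≢ 0V
      invClosed : ∀ i → ∃ λ j → lookup S j ≡ -V (lookup S i)

  module _ (CM : CayleyMap) where
    open CayleyMap CM

    data InSpan : V → Set where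
      sp-0   : InSpan 0V
      sp-add : ∀ i {v} → InSpan v → InSpan (lookup S i +V v)

    Generating : Set
    Generating = ∀ v → InSpan v

    next : Fin (suc d) → Fin (suc d)
    next i = suc (toℕ i) mod (suc d)

    s : Fin (suc d) → V
    s = lookup S

    -- orientation-preserving map automorphism: a vertex bijection mapping
    -- each arc (g, g+sᵢ) to an arc (φ g, φ g + sⱼ) and respecting the local
    -- rotation (g, g+sᵢ) ↦ (g, g+ρ(sᵢ))
    IsAut : Map → Set
    IsAut φ = IsBijection φ ×
      (∀ g i → ∃ λ j → (φ (g +V s i) ≡ φ g +V s j)
                      × (φ (g +V s (next i)) ≡ φ g +V s (next j)))

    IsRegular : Set
    IsRegular = ∀ g h i j →
      (∃ λ φ → IsAut φ × (φ g ≡ h) × (φ (g +V s i) ≡ h +V s j)) ×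
      (∀ φ ψ → IsAut φ → φ g ≡ h → φ (g +V s i) ≡ h +V s j →
               IsAut ψ → ψ g ≡ h → ψ (g +V s i) ≡ h +V s j → φ ≈ ψ)

    -- X = Aut(CM), transported along the vertex relabelling θ (inverse θ')
    -- that identifies X with a subgroup of AGL(n,p)
    InX : Map → Map → Map → Set
    InX θ θ' φ = Σ Map λ ψ → IsAut ψ × (φ ≈ (θ ∘M (ψ ∘M θ')))

  data Gen (σ : Mat) (ℓ : Map) : Map → Set where
    g-id   : Gen σ ℓ idM
    g-σ    : ∀ {φ} → Gen σ ℓ φ → Gen σ ℓ (lin σ ∘M φ)
    g-σinv : ∀ {φ} ψ → (ψ ∘M lin σ) ≈ idM → (lin σ ∘M ψ) ≈ idM → Gen σ ℓ φ → Gen σ ℓ (ψ ∘M φ)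
    g-ℓ    : ∀ {φ} → Gen σ ℓ φ → Gen σ ℓ (ℓ ∘M φ)
    g-resp : ∀ {φ ψ} → φ ≈ ψ → Gen σ ℓ φ → Gen σ ℓ ψ

  data NormalClosure (X : Map → Set) (t : V) : Map → Set where
    nc-id   : NormalClosure X t idM
    nc-conj : ∀ {φ} x x' → X x → (x' ∘M x) ≈ idM → (x ∘M x') ≈ idM →
              NormalClosure X t φ → NormalClosure X t ((x ∘M (trans t ∘M x')) ∘M φ)
    nc-resp : ∀ {φ ψ} → φ ≈ ψ → NormalClosure X t φ → NormalClosure X t ψ

-- Every element of X is affine, t_w σʲ; write ℓ = t_v σⁱ. As X = ⟨σ, ℓ⟩ contains T, following translation
-- parts through words in σ, σ⁻¹ and ℓ shows that every σ-stable subgroup of V containing v is V. Two such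
-- subgroups are {w | σⁱ w = -w} (it contains v because ℓ² = 1 gives v + σⁱ v = 0) and
-- {w | t_w ∈ ⟨t_v⟩^X}; hence σⁱ = -I, ℓ = t_v(-I), and ⟨t_v⟩^X = T, conjugates of translations being
-- translations. For p odd, -I ≠ I, so r = i mod |σ| is nonzero with σ^(2r) = 1, which forces 2r = |σ|.
{-# OPTIONS --safe #-}
module Submission where

open import Defs
open import Data.Nat
  using (ℕ; NonZero; _*_; _^_; _/_; zero; suc; pred; _+_; _∸_; _%_; _<_; z≤n; z<s; >-nonZero⁻¹; ≢-nonZero)
open import Data.Nat.Divisibility using (_∣_; divides; _∣0)
open import Data.Nat.Primality using (Prime; prime⇒irreducible)
open import Data.Product using (Σ; ∃; _×_; _,_; proj₁; proj₂)
open import Relation.Nullary using (¬_)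

open import Algebra.Bundles using (AbelianGroup)
open import Algebra.Structures using (IsAbelianGroup)
import Algebra.Properties.AbelianGroup as AbelianGroupProperties
import Algebra.Properties.CommutativeSemigroup as CommutativeSemigroupProperties
open import Data.Empty using (⊥-elim)
open import Data.Fin as Fin using (toℕ)
open import Data.Fin.Properties using (toℕ-injective; toℕ<n; toℕ-fromℕ<)
open import Data.Nat.DivMod
open import Data.Nat.Properties
open import Data.Sum using (inj₁; inj₂)
open import Data.Vec using (Vec; []; _∷_; map; zipWith; foldr′; replicate)
open import Data.Vec.Properties
  using (zipWith-assoc; zipWith-identityˡ; zipWith-identityʳ; zipWith-inverseˡ; zipWith-inverseʳ;
         zipWith-comm; ∷-injectiveˡ; ∷-injectiveʳ)
open import Level using (0ℓ)
open import Relation.Binary.Definitions using (tri<; tri≈; tri>)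
open import Relation.Binary.PropositionalEquality as ≡
  using (_≡_; _≢_; refl; sym; cong; cong₂; subst; isEquivalence; module ≡-Reasoning)
open ≡-Reasoning

zipWith-isAbelianGroup : ∀ {a} {A : Set a} {_∙_ : A → A → A} {ε : A} {_⁻¹ : A → A} →
  IsAbelianGroup _≡_ _∙_ ε _⁻¹ →
  ∀ m → IsAbelianGroup _≡_ (zipWith {n = m} _∙_) (replicate m ε) (map _⁻¹)
zipWith-isAbelianGroup G m = record
  { isGroup = record
    { isMonoid = record
      { isSemigroup = record
        { isMagma = record { isEquivalence = isEquivalence ; ∙-cong = cong₂ _ }
        ; assoc = zipWith-assoc G.assoc
        }
      ; identity = zipWith-identityˡ G.identityˡ , zipWith-identityʳ G.identityʳ
      }
    ; inverse = zipWith-inverseˡ G.inverseˡ , zipWith-inverseʳ G.inverseʳ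
    ; ⁻¹-cong = cong _
    }
  ; comm = zipWith-comm G.comm
  }
  where module G = IsAbelianGroup G

module ModularArithmetic (p : ℕ) .{{_ : NonZero p}} where
  open Aff p 0 using (F; 0F; _+F_; _*F_; -F_)

  toℕ-mod : ∀ x → toℕ (x mod p) ≡ x % p
  toℕ-mod x = toℕ-fromℕ< (m%n<n x p)

  mod-cong : ∀ {x y} → x % p ≡ y % p → x mod p ≡ y mod p
  mod-cong {x} {y} eq = toℕ-injective (begin
    toℕ (x mod p) ≡⟨ toℕ-mod x ⟩
    x % p         ≡⟨ eq ⟩
    y % p         ≡⟨ toℕ-mod y ⟨
    toℕ (y mod p) ∎)

  toℕ-0F : toℕ 0F ≡ 0
  toℕ-0F = ≡.trans (toℕ-mod 0) (m<n⇒m%n≡m (>-nonZero⁻¹ p))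

  [m%p+n]%p≡[m+n]%p : ∀ m n → (m % p + n) % p ≡ (m + n) % p
  [m%p+n]%p≡[m+n]%p m n = begin
    (m % p + n) % p           ≡⟨ %-distribˡ-+ (m % p) n p ⟩
    (m % p % p + n % p) % p   ≡⟨ cong (λ z → (z + n % p) % p) (m%n%n≡m%n m p) ⟩
    (m % p + n % p) % p       ≡⟨ %-distribˡ-+ m n p ⟨
    (m + n) % p               ∎

  [m*[n%p]]%p≡[m*n]%p : ∀ m n → (m * (n % p)) % p ≡ (m * n) % p
  [m*[n%p]]%p≡[m*n]%p m n = begin
    (m * (n % p)) % p          ≡⟨ %-distribˡ-* m (n % p) p ⟩
    (m % p * (n % p % p)) % p  ≡⟨ cong (λ z → (m % p * z) % p) (m%n%n≡m%n n p) ⟩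
    (m % p * (n % p)) % p      ≡⟨ %-distribˡ-* m n p ⟨
    (m * n) % p                ∎

  +F-comm : ∀ a b → a +F b ≡ b +F a
  +F-comm a b = cong (_mod p) (+-comm (toℕ a) (toℕ b))

  +F-assoc : ∀ a b c → (a +F b) +F c ≡ a +F (b +F c)
  +F-assoc a b c = mod-cong (begin
    (toℕ (a +F b) + toℕ c) % p         ≡⟨ cong (λ z → (z + toℕ c) % p) (toℕ-mod _) ⟩
    ((toℕ a + toℕ b) % p + toℕ c) % p  ≡⟨ [m%p+n]%p≡[m+n]%p (toℕ a + toℕ b) (toℕ c) ⟩
    (toℕ a + toℕ b + toℕ c) % p        ≡⟨ cong (_% p) (+-assoc (toℕ a) (toℕ b) (toℕ c)) ⟩
    (toℕ a + (toℕ b + toℕ c)) % p      ≡⟨ cong (_% p) (+-comm (toℕ a) _) ⟩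
    (toℕ b + toℕ c + toℕ a) % p        ≡⟨ [m%p+n]%p≡[m+n]%p (toℕ b + toℕ c) (toℕ a) ⟨
    ((toℕ b + toℕ c) % p + toℕ a) % p  ≡⟨ cong (λ z → (z + toℕ a) % p) (toℕ-mod _) ⟨
    (toℕ (b +F c) + toℕ a) % p         ≡⟨ cong (_% p) (+-comm _ (toℕ a)) ⟩
    (toℕ a + toℕ (b +F c)) % p         ∎)

  +F-identityˡ : ∀ a → 0F +F a ≡ a
  +F-identityˡ a = begin
    (toℕ 0F + toℕ a) mod p ≡⟨ cong (λ z → (z + toℕ a) mod p) toℕ-0F ⟩
    toℕ a mod p            ≡⟨ toℕ-injective (≡.trans (toℕ-mod (toℕ a)) (m<n⇒m%n≡m (toℕ<n a))) ⟩
    a                      ∎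

  +F-inverseˡ : ∀ a → (-F a) +F a ≡ 0F
  +F-inverseˡ a = mod-cong (begin
    (toℕ (-F a) + toℕ a) % p        ≡⟨ cong (λ z → (z + toℕ a) % p) (toℕ-mod (p ∸ toℕ a)) ⟩
    ((p ∸ toℕ a) % p + toℕ a) % p   ≡⟨ [m%p+n]%p≡[m+n]%p (p ∸ toℕ a) (toℕ a) ⟩
    (p ∸ toℕ a + toℕ a) % p         ≡⟨ cong (_% p) (m∸n+n≡m (<⇒≤ (toℕ<n a))) ⟩
    p % p                           ≡⟨ n%n≡0 p ⟩
    0                               ≡⟨ m<n⇒m%n≡m (>-nonZero⁻¹ p) ⟨
    0 % p                           ∎)

  +F-isAbelianGroup : IsAbelianGroup _≡_ _+F_ 0F -F_
  +F-isAbelianGroup = record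
    { isGroup = record
      { isMonoid = record
        { isSemigroup = record
          { isMagma = record { isEquivalence = isEquivalence ; ∙-cong = cong₂ _+F_ }
          ; assoc = +F-assoc
          }
        ; identity = +F-identityˡ , λ a → ≡.trans (+F-comm a 0F) (+F-identityˡ a)
        }
      ; inverse = +F-inverseˡ , λ a → ≡.trans (+F-comm a (-F a)) (+F-inverseˡ a)
      ; ⁻¹-cong = cong -F_
      }
    ; comm = +F-comm
    }

  +F-abelianGroup : AbelianGroup 0ℓ 0ℓ
  +F-abelianGroup = record { isAbelianGroup = +F-isAbelianGroup }

  *F-distribˡ-+F : ∀ a b c → a *F (b +F c) ≡ (a *F b) +F (a *F c)
  *F-distribˡ-+F a b c = mod-cong (begin
    (toℕ a * toℕ (b +F c)) % p               ≡⟨ cong (λ z → (toℕ a * z) % p) (toℕ-mod _) ⟩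
    (toℕ a * ((toℕ b + toℕ c) % p)) % p      ≡⟨ [m*[n%p]]%p≡[m*n]%p (toℕ a) (toℕ b + toℕ c) ⟩
    (toℕ a * (toℕ b + toℕ c)) % p            ≡⟨ cong (_% p) (*-distribˡ-+ (toℕ a) (toℕ b) (toℕ c)) ⟩
    (toℕ a * toℕ b + toℕ a * toℕ c) % p      ≡⟨ %-distribˡ-+ (toℕ a * toℕ b) (toℕ a * toℕ c) p ⟩
    ((toℕ a * toℕ b) % p + (toℕ a * toℕ c) % p) % p
      ≡⟨ cong₂ (λ u w → (u + w) % p) (toℕ-mod (toℕ a * toℕ b)) (toℕ-mod (toℕ a * toℕ c)) ⟨
    (toℕ (a *F b) + toℕ (a *F c)) % p        ∎)

  -F-fixed⇒0F : Prime p → p ≢ 2 → ∀ a → -F a ≡ a → a ≡ 0F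
  -F-fixed⇒0F pp p≢2 a -a≡a = toℕ-injective (≡.trans (fixed⇒0 (toℕ a) (toℕ<n a) p∸a%p≡a) (sym toℕ-0F))
    where
    p∸a%p≡a : (p ∸ toℕ a) % p ≡ toℕ a
    p∸a%p≡a = ≡.trans (sym (toℕ-mod (p ∸ toℕ a))) (cong toℕ -a≡a)
    fixed⇒0 : ∀ t → t < p → (p ∸ t) % p ≡ t → t ≡ 0
    fixed⇒0 zero    _   _  = refl
    fixed⇒0 (suc t) t<p eq with prime⇒irreducible pp (divides (suc t) p≡[1+t]*2)
      where
      p∸t≡t : p ∸ suc t ≡ suc t
      p∸t≡t = ≡.trans (sym (m<n⇒m%n≡m (∸-monoʳ-< {p} {suc t} {0} z<s (<⇒≤ t<p)))) eq
      p≡[1+t]*2 : p ≡ suc t * 2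
      p≡[1+t]*2 = begin
        p                  ≡⟨ m∸n+n≡m (<⇒≤ t<p) ⟨
        p ∸ suc t + suc t  ≡⟨ cong (_+ suc t) p∸t≡t ⟩
        suc t + suc t      ≡⟨ cong (suc t +_) (+-identityʳ (suc t)) ⟨
        2 * suc t          ≡⟨ *-comm 2 (suc t) ⟩
        suc t * 2          ∎
    ... | inj₁ ()
    ... | inj₂ 2≡p = ⊥-elim (p≢2 (sym 2≡p))

  +V-abelianGroup : ℕ → AbelianGroup 0ℓ 0ℓ
  +V-abelianGroup m = record { isAbelianGroup = zipWith-isAbelianGroup +F-isAbelianGroup m }

  -V-fixed⇒0V : Prime p → p ≢ 2 → ∀ {m} (x : Vec F m) → map -F_ x ≡ x → x ≡ replicate m 0F
  -V-fixed⇒0V pp p≢2 []      _    = refl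
  -V-fixed⇒0V pp p≢2 (a ∷ x) -x≡x =
    cong₂ _∷_ (-F-fixed⇒0F pp p≢2 a (∷-injectiveˡ -x≡x)) (-V-fixed⇒0V pp p≢2 x (∷-injectiveʳ -x≡x))

  -- `lin A` from Defs unfolds to `λ x → map (_· x) A`.
  _·_ : ∀ {m} → Vec F m → Vec F m → F
  r · x = foldr′ _+F_ 0F (zipWith _*F_ r x)

  ·-distribˡ-+V : ∀ {m} (r x y : Vec F m) → r · zipWith _+F_ x y ≡ (r · x) +F (r · y)
  ·-distribˡ-+V []      []      []      = sym (+F-identityˡ 0F)
  ·-distribˡ-+V (a ∷ r) (b ∷ x) (c ∷ y) = begin
    (a *F (b +F c)) +F (r · zipWith _+F_ x y)     ≡⟨ cong₂ _+F_ (*F-distribˡ-+F a b c) (·-distribˡ-+V r x y) ⟩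
    ((a *F b) +F (a *F c)) +F ((r · x) +F (r · y)) ≡⟨ interchange (a *F b) (a *F c) (r · x) (r · y) ⟩
    ((a *F b) +F (r · x)) +F ((a *F c) +F (r · y)) ∎
    where open CommutativeSemigroupProperties (AbelianGroup.commutativeSemigroup +F-abelianGroup)

  IsAdditive : ∀ {m k} → (Vec F m → Vec F k) → Set
  IsAdditive f = ∀ x y → f (zipWith _+F_ x y) ≡ zipWith _+F_ (f x) (f y)

  matrix-additive : ∀ {m k} (A : Vec (Vec F m) k) → IsAdditive (λ x → map (_· x) A)
  matrix-additive []      x y = refl
  matrix-additive (r ∷ A) x y = cong₂ _∷_ (·-distribˡ-+V r x y) (matrix-additive A x y)

  module _ {m k} {f : Vec F m → Vec F k} (f-additive : IsAdditive f) where
    private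
      module Vₘ = AbelianGroup (+V-abelianGroup m)
      module Vₖ = AbelianGroupProperties (+V-abelianGroup k)

    additive⇒zero : f (replicate m 0F) ≡ replicate k 0F
    additive⇒zero = Vₖ.identityʳ-unique (f 𝟎) (f 𝟎) (begin
      zipWith _+F_ (f 𝟎) (f 𝟎) ≡⟨ f-additive 𝟎 𝟎 ⟨
      f (zipWith _+F_ 𝟎 𝟎)     ≡⟨ cong f (Vₘ.identityˡ 𝟎) ⟩
      f 𝟎                      ∎)
      where
      𝟎 : Vec F m
      𝟎 = replicate m 0F

    additive⇒neg : ∀ x → f (map -F_ x) ≡ map -F_ (f x)
    additive⇒neg x = Vₖ.inverseʳ-unique (f x) (f (map -F_ x)) (begin
      zipWith _+F_ (f x) (f (map -F_ x)) ≡⟨ f-additive x (map -F_ x) ⟨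
      f (zipWith _+F_ x (map -F_ x))     ≡⟨ cong f (Vₘ.inverseʳ x) ⟩
      f (replicate m 0F)                 ≡⟨ additive⇒zero ⟩
      replicate k 0F                     ∎)

module MapPowers (p : ℕ) .{{_ : NonZero p}} (n : ℕ) where
  open Aff p n
  open ModularArithmetic p using (IsAdditive)

  pow-+ : ∀ f a b → pow f (a + b) ≈ (pow f a ∘M pow f b)
  pow-+ f zero    b x = refl
  pow-+ f (suc a) b x = cong f (pow-+ f a b x)

  pow-comm : ∀ f i → (pow f i ∘M f) ≈ (f ∘M pow f i)
  pow-comm f zero    x = refl
  pow-comm f (suc i) x = cong f (pow-comm f i x)

  pow-*-id : ∀ f {N} → pow f N ≈ idM → ∀ q → pow f (q * N) ≈ idM
  pow-*-id f     fᴺ≈id zero    x = refl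
  pow-*-id f {N} fᴺ≈id (suc q) x = ≡.trans (pow-+ f N (q * N) x) (≡.trans (fᴺ≈id _) (pow-*-id f fᴺ≈id q x))

  pow-% : ∀ f {N} .{{_ : NonZero N}} → pow f N ≈ idM → ∀ i → pow f (i % N) ≈ pow f i
  pow-% f {N} fᴺ≈id i x = begin
    pow f (i % N) x                       ≡⟨ cong (pow f (i % N)) (pow-*-id f fᴺ≈id (i / N) x) ⟨
    pow f (i % N) (pow f (i / N * N) x)   ≡⟨ pow-+ f (i % N) (i / N * N) x ⟨
    pow f (i % N + i / N * N) x           ≡⟨ cong (λ j → pow f j x) (m≡m%n+[m/n]*n i N) ⟨
    pow f i x                             ∎

  leftInverse≈pow : ∀ f {M ψ} → pow f (suc M) ≈ idM → (ψ ∘M f) ≈ idM → ψ ≈ pow f M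
  leftInverse≈pow f {M} {ψ} fᴹ⁺¹≈id ψf≈id y = ≡.trans (cong ψ (sym (fᴹ⁺¹≈id y))) (ψf≈id (pow f M y))

  pow-additive : ∀ {f} → IsAdditive f → ∀ i → IsAdditive (pow f i)
  pow-additive     f-additive zero    x y = refl
  pow-additive {f} f-additive (suc i) x y = ≡.trans (cong f (pow-additive f-additive i x y)) (f-additive _ _)

  double≡order : ∀ {f N r} → HasOrder f N → 0 < r → r < N → pow f (r + r) ≈ idM → r + r ≡ N
  double≡order {f} {N} {r} (fᴺ≈id , minimal) 0<r r<N f²ʳ≈id with <-cmp (r + r) N
  ... | tri< 2r<N _ _ = ⊥-elim (minimal (r + r) (+-mono-<-≤ 0<r z≤n) 2r<N f²ʳ≈id)
  ... | tri≈ _ 2r≡N _ = 2r≡N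
  ... | tri> _ _ N<2r = ⊥-elim (minimal d (m<n⇒0<n∸m N<2r) d<N fᵈ≈id)
    where
    d : ℕ
    d = r + r ∸ N
    d<N : d < N
    d<N = subst (d <_) (m+n∸n≡m N N) (∸-monoˡ-< (+-mono-< r<N r<N) (<⇒≤ N<2r))
    fᵈ≈id : pow f d ≈ idM
    fᵈ≈id x = begin
      pow f d x              ≡⟨ cong (pow f d) (fᴺ≈id x) ⟨
      pow f d (pow f N x)    ≡⟨ pow-+ f d N x ⟨
      pow f (d + N) x        ≡⟨ cong (λ j → pow f j x) (m∸n+n≡m (<⇒≤ N<2r)) ⟩
      pow f (r + r) x        ≡⟨ f²ʳ≈id x ⟩
      x                      ∎

module CayleyMapAutomorphisms (p : ℕ) .{{_ : NonZero p}} (n : ℕ) (CM : Aff.CayleyMap p n) where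
  open Aff p n

  isAut-id : IsAut CM idM
  isAut-id = (idM , (λ _ → refl) , (λ _ → refl)) , λ g i → i , refl , refl

  isAut-∘ : ∀ {a b} → IsAut CM a → IsAut CM b → IsAut CM (a ∘M b)
  isAut-∘ {a} {b} ((a⁻¹ , a⁻¹a≈id , aa⁻¹≈id) , a-arcs) ((b⁻¹ , b⁻¹b≈id , bb⁻¹≈id) , b-arcs) =
    (b⁻¹ ∘M a⁻¹ ,
     (λ x → ≡.trans (cong b⁻¹ (a⁻¹a≈id (b x))) (b⁻¹b≈id x)) ,
     (λ x → ≡.trans (cong a (bb⁻¹≈id (a⁻¹ x))) (aa⁻¹≈id x))) ,
    λ g i → let (j , b-arc , b-rot) = b-arcs g i
                (j' , a-arc , a-rot) = a-arcs (b g) j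
            in j' , ≡.trans (cong a b-arc) a-arc , ≡.trans (cong a b-rot) a-rot

module AffineRepresentation (p : ℕ) .{{_ : NonZero p}} (n : ℕ) where
  open Aff p n
  open ModularArithmetic p
  open MapPowers p n
  open AbelianGroup (+V-abelianGroup n) using (assoc; comm; identityˡ; identityʳ)
  open AbelianGroupProperties (+V-abelianGroup n) using (inverseʳ-unique; ε⁻¹≈ε; ⁻¹-∙-comm; ⁻¹-involutive)

  module InvolutionOfRegularCayleyMap
    (CM : CayleyMap) (θ θ' : Map) (θ'θ≈id : (θ' ∘M θ) ≈ idM) (θθ'≈id : (θ ∘M θ') ≈ idM)
    (σ : Mat) (Xσ : InX CM θ θ' (lin σ)) (N : ℕ) .{{_ : NonZero N}} (σ-order : HasOrder (lin σ) N)
    (X∋trans : ∀ v → InX CM θ θ' (trans v))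
    (X-decomp : ∀ φ → InX CM θ θ' φ → Σ V λ v → ∃ λ i → φ ≈ (trans v ∘M pow (lin σ) i))
    (ℓ : Map) (Xℓ : InX CM θ θ' ℓ) (ℓ-involution : IsInvolution ℓ)
    (X⊆Gen : ∀ φ → InX CM θ θ' φ → Gen σ ℓ φ)
    where

    open CayleyMapAutomorphisms p n CM

    X : Map → Set
    X = InX CM θ θ'

    L : Map
    L = lin σ

    L⁻¹ : Map
    L⁻¹ = pow L (pred N)

    L∘L⁻¹≈id : (L ∘M L⁻¹) ≈ idM
    L∘L⁻¹≈id = subst (λ K → pow L K ≈ idM) (sym (suc-pred N)) (proj₁ σ-order)

    L⁻¹∘L≈id : (L⁻¹ ∘M L) ≈ idM
    L⁻¹∘L≈id x = ≡.trans (pow-comm L (pred N) x) (L∘L⁻¹≈id x)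

    Lʲ-additive : ∀ j → IsAdditive (pow L j)
    Lʲ-additive = pow-additive (matrix-additive σ)

    X-id : X idM
    X-id = idM , isAut-id , λ x → sym (θθ'≈id x)

    X-∘ : ∀ {a b} → X a → X b → X (a ∘M b)
    X-∘ {a} {b} (ψ₁ , ψ₁-aut , a≈) (ψ₂ , ψ₂-aut , b≈) =
      ψ₁ ∘M ψ₂ , isAut-∘ ψ₁-aut ψ₂-aut ,
      λ x → ≡.trans (a≈ (b x)) (cong (θ ∘M ψ₁) (≡.trans (cong θ' (b≈ x)) (θ'θ≈id (ψ₂ (θ' x)))))

    v : V
    v = proj₁ (X-decomp ℓ Xℓ)

    i : ℕ
    i = proj₁ (proj₂ (X-decomp ℓ Xℓ))

    ℓ≈tᵥ∘Lⁱ : ℓ ≈ (trans v ∘M pow L i)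
    ℓ≈tᵥ∘Lⁱ = proj₂ (proj₂ (X-decomp ℓ Xℓ))

    record IsσStableSubgroup (Q : V → Set) : Set where
      field
        0V∈ : Q 0V
        σ-closed : ∀ {w} → Q w → Q (L w)
        +V-closed : ∀ {a b} → Q a → Q b → Q (a +V b)

    module _ {Q : V → Set} (Q-stable : IsσStableSubgroup Q) (v∈Q : Q v) where
      open IsσStableSubgroup Q-stable

      pow-closed : ∀ j {w} → Q w → Q (pow L j w)
      pow-closed zero    w∈Q = w∈Q
      pow-closed (suc j) w∈Q = σ-closed (pow-closed j w∈Q)

      AffineOverQ : Map → Set
      AffineOverQ φ = Σ V λ w → Σ ℕ λ j → Q w × (φ ≈ (trans w ∘M pow L j))

      AffineOverQ-∘ : ∀ {g φ} a j → Q a → g ≈ (trans a ∘M pow L j) → AffineOverQ φ → AffineOverQ (g ∘M φ)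
      AffineOverQ-∘ {g} {φ} a j a∈Q g≈ (w , k , w∈Q , φ≈) =
        a +V pow L j w , j + k , +V-closed a∈Q (pow-closed j w∈Q) , λ x → begin
          g (φ x)                                    ≡⟨ g≈ (φ x) ⟩
          a +V pow L j (φ x)                         ≡⟨ cong (λ y → a +V pow L j y) (φ≈ x) ⟩
          a +V pow L j (w +V pow L k x)              ≡⟨ cong (a +V_) (Lʲ-additive j w _) ⟩
          a +V (pow L j w +V pow L j (pow L k x))    ≡⟨ assoc a _ _ ⟨
          (a +V pow L j w) +V pow L j (pow L k x)    ≡⟨ cong ((a +V pow L j w) +V_) (pow-+ L j k x) ⟨
          (a +V pow L j w) +V pow L (j + k) x        ∎

      Gen⇒AffineOverQ : ∀ {φ} → Gen σ ℓ φ → AffineOverQ φ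
      Gen⇒AffineOverQ g-id = 0V , 0 , 0V∈ , λ x → sym (identityˡ x)
      Gen⇒AffineOverQ (g-σ g) =
        AffineOverQ-∘ 0V 1 0V∈ (λ x → sym (identityˡ (L x))) (Gen⇒AffineOverQ g)
      Gen⇒AffineOverQ (g-σinv ψ ψL≈id _ g) =
        AffineOverQ-∘ {ψ} 0V (pred N) 0V∈
          (λ x → ≡.trans (leftInverse≈pow L {pred N} L∘L⁻¹≈id ψL≈id x) (sym (identityˡ _)))
          (Gen⇒AffineOverQ g)
      Gen⇒AffineOverQ (g-ℓ g) = AffineOverQ-∘ v i v∈Q ℓ≈tᵥ∘Lⁱ (Gen⇒AffineOverQ g)
      Gen⇒AffineOverQ (g-resp φ≈ψ g) with Gen⇒AffineOverQ g
      ... | w , j , w∈Q , φ≈ = w , j , w∈Q , λ x → ≡.trans (sym (φ≈ψ x)) (φ≈ x)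

      σ-stable∋v⇒everything : ∀ y → Q y
      σ-stable∋v⇒everything y with Gen⇒AffineOverQ (X⊆Gen (trans y) (X∋trans y))
      ... | w , j , w∈Q , tʸ≈ = subst Q w≡y w∈Q
        where
        w≡y : w ≡ y
        w≡y = begin
          w                   ≡⟨ identityʳ w ⟨
          w +V 0V             ≡⟨ cong (w +V_) (additive⇒zero (Lʲ-additive j)) ⟨
          w +V pow L j 0V     ≡⟨ tʸ≈ 0V ⟨
          y +V 0V             ≡⟨ identityʳ y ⟩
          y                   ∎

    Lⁱv≡-v : pow L i v ≡ -V v
    Lⁱv≡-v = inverseʳ-unique v (pow L i v) (begin
      v +V pow L i v   ≡⟨ ℓ≈tᵥ∘Lⁱ v ⟨
      ℓ v              ≡⟨ cong ℓ ℓ0V≡v ⟨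
      ℓ (ℓ 0V)         ≡⟨ proj₁ ℓ-involution 0V ⟩
      0V               ∎)
      where
      ℓ0V≡v : ℓ 0V ≡ v
      ℓ0V≡v = ≡.trans (ℓ≈tᵥ∘Lⁱ 0V) (≡.trans (cong (v +V_) (additive⇒zero (Lʲ-additive i))) (identityʳ v))

    Lⁱ≈-I : pow L i ≈ negI
    Lⁱ≈-I = σ-stable∋v⇒everything negated-by-Lⁱ Lⁱv≡-v
      where
      negated-by-Lⁱ : IsσStableSubgroup (λ w → pow L i w ≡ -V w)
      negated-by-Lⁱ = record
        { 0V∈ = ≡.trans (additive⇒zero (Lʲ-additive i)) (sym ε⁻¹≈ε)
        ; σ-closed = λ {w} Lⁱw≡-w → begin
            pow L i (L w)   ≡⟨ pow-comm L i w ⟩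
            L (pow L i w)   ≡⟨ cong L Lⁱw≡-w ⟩
            L (-V w)        ≡⟨ additive⇒neg (matrix-additive σ) w ⟩
            -V (L w)        ∎
        ; +V-closed = λ {a} {b} Lⁱa≡-a Lⁱb≡-b → begin
            pow L i (a +V b)          ≡⟨ Lʲ-additive i a b ⟩
            pow L i a +V pow L i b    ≡⟨ cong₂ _+V_ Lⁱa≡-a Lⁱb≡-b ⟩
            (-V a) +V (-V b)          ≡⟨ ⁻¹-∙-comm a b ⟩
            -V (a +V b)               ∎
        }

    ℓ≈tᵥ∘-I : ℓ ≈ (trans v ∘M negI)
    ℓ≈tᵥ∘-I x = ≡.trans (ℓ≈tᵥ∘Lⁱ x) (cong (v +V_) (Lⁱ≈-I x))

    conjugate-of-translation : ∀ {x x'} → X x → (x ∘M x') ≈ idM → ∀ t →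
      Σ V λ u → (x ∘M (trans t ∘M x')) ≈ trans u
    conjugate-of-translation {x} {x'} Xx xx'≈id t with X-decomp x Xx
    ... | w , j , x≈ = pow L j t , λ y → begin
      x (t +V x' y)                           ≡⟨ x≈ _ ⟩
      w +V pow L j (t +V x' y)                ≡⟨ cong (w +V_) (Lʲ-additive j t (x' y)) ⟩
      w +V (pow L j t +V pow L j (x' y))      ≡⟨ assoc w _ _ ⟨
      (w +V pow L j t) +V pow L j (x' y)      ≡⟨ cong (_+V pow L j (x' y)) (comm w _) ⟩
      (pow L j t +V w) +V pow L j (x' y)      ≡⟨ assoc _ w _ ⟩
      pow L j t +V (w +V pow L j (x' y))      ≡⟨ cong (pow L j t +V_) (x≈ (x' y)) ⟨
      pow L j t +V x (x' y)                   ≡⟨ cong (pow L j t +V_) (xx'≈id y) ⟩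
      pow L j t +V y                          ∎

    NC-∘ : ∀ {φ χ} → NormalClosure X v φ → NormalClosure X v χ → NormalClosure X v (φ ∘M χ)
    NC-∘ nc-id                             χ∈ = χ∈
    NC-∘ (nc-conj x x' Xx x'x≈id xx'≈id φ∈) χ∈ = nc-conj x x' Xx x'x≈id xx'≈id (NC-∘ φ∈ χ∈)
    NC-∘ {χ = χ} (nc-resp φ≈ψ φ∈)          χ∈ = nc-resp (λ y → φ≈ψ (χ y)) (NC-∘ φ∈ χ∈)

    NC-conjσ : ∀ {φ} → NormalClosure X v φ → NormalClosure X v (L ∘M (φ ∘M L⁻¹))
    NC-conjσ nc-id = nc-resp (λ x → sym (L∘L⁻¹≈id x)) nc-id
    NC-conjσ (nc-conj {φ} x x' Xx x'x≈id xx'≈id φ∈) =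
      nc-resp (λ y → cong (λ z → L (x (v +V x' z))) (L⁻¹∘L≈id (φ (L⁻¹ y))))
        (nc-conj (L ∘M x) (x' ∘M L⁻¹) (X-∘ Xσ Xx)
          (λ y → ≡.trans (cong x' (L⁻¹∘L≈id (x y))) (x'x≈id y))
          (λ y → ≡.trans (cong L (xx'≈id (L⁻¹ y))) (L∘L⁻¹≈id y))
          (NC-conjσ φ∈))
    NC-conjσ (nc-resp φ≈ψ φ∈) = nc-resp (λ y → cong L (φ≈ψ (L⁻¹ y))) (NC-conjσ φ∈)

    NC∋trans : ∀ w → NormalClosure X v (trans w)
    NC∋trans = σ-stable∋v⇒everything translations-in-NC tᵥ∈NC
      where
      tᵥ∈NC : NormalClosure X v (trans v)
      tᵥ∈NC = nc-resp (λ _ → refl) (nc-conj idM idM X-id (λ _ → refl) (λ _ → refl) nc-id)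
      translations-in-NC : IsσStableSubgroup (λ w → NormalClosure X v (trans w))
      translations-in-NC = record
        { 0V∈ = nc-resp (λ x → sym (identityˡ x)) nc-id
        ; σ-closed = λ {w} tʷ∈NC → nc-resp
            (λ y → ≡.trans (matrix-additive σ w (L⁻¹ y)) (cong (L w +V_) (L∘L⁻¹≈id y)))
            (NC-conjσ tʷ∈NC)
        ; +V-closed = λ {a} {b} tᵃ∈NC tᵇ∈NC → nc-resp (λ x → sym (assoc a b x)) (NC-∘ tᵃ∈NC tᵇ∈NC)
        }

    NC⇒translation : ∀ {φ} → NormalClosure X v φ → Σ V λ u → φ ≈ trans u
    NC⇒translation nc-id = 0V , λ x → sym (identityˡ x)
    NC⇒translation (nc-conj {φ} x x' Xx _ xx'≈id φ∈)
      with conjugate-of-translation Xx xx'≈id v | NC⇒translation φ∈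
    ... | u , conj≈ | w , φ≈ = u +V w , λ y → begin
      x (v +V x' (φ y))   ≡⟨ conj≈ (φ y) ⟩
      u +V φ y            ≡⟨ cong (u +V_) (φ≈ y) ⟩
      u +V (w +V y)       ≡⟨ assoc u w y ⟨
      (u +V w) +V y       ∎
    NC⇒translation (nc-resp φ≈ψ φ∈) with NC⇒translation φ∈
    ... | u , φ≈ = u , λ x → ≡.trans (sym (φ≈ψ x)) (φ≈ x)

    -I≉id : Prime p → p ≢ 2 → ¬ (negI ≈ idM)
    -I≉id pp p≢2 -I≈id = CayleyMap.nonzero CM Fin.zero (-V-fixed⇒0V pp p≢2 _ (-I≈id _))

    L^[N/2]≈-I : Prime p → p ≢ 2 → pow L (N / 2) ≈ negI
    L^[N/2]≈-I pp p≢2 x = ≡.trans (cong (λ j → pow L j x) N/2≡r) (Lʳ≈-I x)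
      where
      r : ℕ
      r = i % N
      Lʳ≈-I : pow L r ≈ negI
      Lʳ≈-I x = ≡.trans (pow-% L (proj₁ σ-order) i x) (Lⁱ≈-I x)
      0<r : 0 < r
      0<r = n≢0⇒n>0 λ r≡0 → -I≉id pp p≢2 λ y →
        ≡.trans (sym (Lʳ≈-I y)) (cong (λ j → pow L j y) r≡0)
      L²ʳ≈id : pow L (r + r) ≈ idM
      L²ʳ≈id y = begin
        pow L (r + r) y       ≡⟨ pow-+ L r r y ⟩
        pow L r (pow L r y)   ≡⟨ Lʳ≈-I _ ⟩
        -V (pow L r y)        ≡⟨ cong -V_ (Lʳ≈-I y) ⟩
        -V (-V y)             ≡⟨ ⁻¹-involutive y ⟩
        y                     ∎
      N/2≡r : N / 2 ≡ r
      N/2≡r = begin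
        N / 2        ≡⟨ cong (_/ 2) (double≡order σ-order 0<r (m%n<n i N) L²ʳ≈id) ⟨
        (r + r) / 2  ≡⟨ cong (λ z → (r + z) / 2) (+-identityʳ r) ⟨
        (2 * r) / 2  ≡⟨ cong (_/ 2) (*-comm 2 r) ⟩
        (r * 2) / 2  ≡⟨ m*n/n≡m r 2 ⟩
        r            ∎

lemma4p1 : (p : ℕ) .{{nz : NonZero p}} → Prime p → (n : ℕ) →
    let open Aff p n in
    (CM : CayleyMap) → Generating CM → IsRegular CM →
    (θ θ' : Map) → (θ' ∘M θ) ≈ idM → (θ ∘M θ') ≈ idM →
    let X = InX CM θ θ' in
    (σ : Mat) → IsInvertible σ → X (lin σ) →
    (k m : ℕ) → ¬ (p ∣ k) → HasOrder (lin σ) (k * p ^ m) →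
    (∀ φ → X φ → φ 0V ≡ 0V → ∃ λ i → φ ≈ pow (lin σ) i) →
    (∀ v → X (trans v)) →
    (∀ φ → X φ → Σ V λ v → ∃ λ i → φ ≈ (trans v ∘M pow (lin σ) i)) →
    (ℓ : Map) → X ℓ → IsInvolution ℓ →
    (∀ φ → X φ → Gen σ ℓ φ) →
    (Σ V λ t → (ℓ ≈ (trans t ∘M negI)) ×
       (∀ φ → (NormalClosure X t φ → Σ V λ v → φ ≈ trans v) ×
              ((Σ V λ v → φ ≈ trans v) → NormalClosure X t φ)))
    × (p ≢ 2 → pow (lin σ) ((k * p ^ m) / 2) ≈ negI)
lemma4p1 p pp n CM _ _ θ θ' θ'θ≈id θθ'≈id σ _ Xσ k m p∤k σ-order _ X∋trans X-decomp ℓ Xℓ ℓ-involution X⊆Gen =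
  (v , ℓ≈tᵥ∘-I , λ φ → NC⇒translation , λ (w , φ≈tʷ) → nc-resp (λ x → sym (φ≈tʷ x)) (NC∋trans w)) ,
  L^[N/2]≈-I pp
  where
  instance
    k≢0 : NonZero k
    k≢0 = ≢-nonZero λ k≡0 → p∤k (subst (p ∣_) (sym k≡0) (p ∣0))
    N≢0 : NonZero (k * p ^ m)
    N≢0 = m*n≢0 k (p ^ m) {{k≢0}} {{m^n≢0 p m}}
  open Aff p n using (nc-resp)
  open AffineRepresentation.InvolutionOfRegularCayleyMap p n CM θ θ' θ'θ≈id θθ'≈id σ Xσ (k * p ^ m) σ-order
    X∋trans X-decomp ℓ Xℓ ℓ-involution X⊆Gen
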